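{- Let $\mathrm{Rec}$ be the model over $\mathbb N$ consisting of all total recursive functions $\mathbb N\to\mathbb N$. Then $\mathrm{Rec}$ is complete: for every model $M$ over $\mathbb N$ with $M\supseteq\mathrm{Rec}$ and $\mathrm{Rec}\succsim M$, we have $M=\mathrm{Rec}$. In particular, there is no hypercomputational model $M$ with $\mathrm{Rec}\succsim M$.
   Context: A model of computation over a set $D$ is any set of functions $f:D\to D\cup\{\bot\}$, where $\bot$ denotes "undefined". An encoding is an injection $\rho:\mathrm{dom}\,B\to\mathrm{dom}\,A$, extended by $\rho(\bot)=\bot$. Model $A$ simulates model $B$ via $\rho$, written $A\succsim_\rho B$, if for every $g\in B$ there is $f\in A$ with $\rho\circ g=f\circ\rho$. $A\succsim B$ means $A\succsim_\rho B$ for some injection $\rho$. For an injection $\rho:E\to D$ and a model $M$ over $D$, $\rho^{ -1}\circ M\circ\rho$ denotes the set of all functions $g:E\to E\cup\{\bot\}$ such that $\rho\circ g=f\circ\rho$ for some $f\in M$. A model $M$ is hypercomputational if there is an injection $\rho:\mathbb N\to\mathrm{dom}\,M$ such that $\rho^{ -1}\circ M\circ\rho\supsetneq\mathrm{Rec}$. -}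

module Defs where

open import Data.Nat using (ℕ; zero; suc; _<_)
open import Data.Fin using (Fin)
open import Data.Vec using (Vec; []; _∷_; lookup)
open import Data.Maybe using (Maybe; just; nothing) renaming (map to mapMaybe)
open import Data.Product using (Σ; ∃; _×_; _,_)
open import Relation.Binary.PropositionalEquality using (_≡_)
open import Relation.Nullary using (¬_)
open import Function.Definitions using (Injective)

data PR : ℕ → Set where
  zeroF : ∀ {n} → PR n
  succF : PR 1
  projF : ∀ {n} → Fin n → PR n
  compF : ∀ {m n} → PR m → (Fin m → PR n) → PR n
  precF : ∀ {n} → PR n → PR (suc (suc n)) → PR (suc n)
  muF   : ∀ {n} → PR (suc n) → PR n

data Eval : ∀ {n} → PR n → Vec ℕ n → ℕ → Set where
  evZero : ∀ {n} {xs : Vec ℕ n} → Eval zeroF xs 0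
  evSucc : ∀ {x} → Eval succF (x ∷ []) (suc x)
  evProj : ∀ {n} {i : Fin n} {xs} → Eval (projF i) xs (lookup xs i)
  evComp : ∀ {m n} {f : PR m} {gs : Fin m → PR n} {xs} {y}
           (ys : Vec ℕ m) →
           (∀ i → Eval (gs i) xs (lookup ys i)) →
           Eval f ys y →
           Eval (compF f gs) xs y
  evPrec0 : ∀ {n} {g : PR n} {h} {xs} {y} →
            Eval g xs y → Eval (precF g h) (0 ∷ xs) y
  evPrecS : ∀ {n} {g : PR n} {h} {xs} {k} {r} {y} →
            Eval (precF g h) (k ∷ xs) r →
            Eval h (k ∷ r ∷ xs) y →
            Eval (precF g h) (suc k ∷ xs) y
  evMu    : ∀ {n} {c : PR (suc n)} {xs} {y} →
            Eval c (y ∷ xs) 0 →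
            (∀ z → z < y → ∃ λ k → Eval c (z ∷ xs) (suc k)) →
            Eval (muF c) xs y

-- Models of computation over a set D: sets of functions D → D ∪ {⊥},
-- with ⊥ represented by nothing.

Model : Set → Set₁
Model D = (D → Maybe D) → Set

Rec : Model ℕ
Rec f = Σ (PR 1) λ c → ∀ x → ∃ λ y → (f x ≡ just y) × Eval c (x ∷ []) y

_⊆_ : ∀ {D} → Model D → Model D → Set
M ⊆ N = ∀ f → M f → N f

_≐_ : ∀ {D} → Model D → Model D → Set
M ≐ N = (M ⊆ N) × (N ⊆ M)

_⊊_ : ∀ {D} → Model D → Model D → Set
M ⊊ N = (M ⊆ N) × ∃ λ g → N g × ¬ M g

-- ρ ∘ g = f ∘ ρ, with ρ(⊥) = ⊥
Commutes : ∀ {D E} → (E → D) → (E → Maybe E) → (D → Maybe D) → Set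
Commutes ρ g f = ∀ x → mapMaybe ρ (g x) ≡ f (ρ x)

SimulatesVia : ∀ {D E} → Model D → Model E → (E → D) → Set
SimulatesVia A B ρ = Injective _≡_ _≡_ ρ × (∀ g → B g → ∃ λ f → A f × Commutes ρ g f)

Simulates : ∀ {D E} → Model D → Model E → Set
Simulates {D} {E} A B = Σ (E → D) λ ρ → SimulatesVia A B ρ

Pullback : ∀ {D E} → (E → D) → Model D → Model E
Pullback ρ M g = ∃ λ f → M f × Commutes ρ g f

Hypercomputational : ∀ {D} → Model D → Set
Hypercomputational {D} M =
  Σ (ℕ → D) λ ρ → Injective _≡_ _≡_ ρ × (Rec ⊊ Pullback ρ M)

-- An injective encoding τ : ℕ → ℕ under which Rec simulates the successor is
-- itself recursive: τ (1 + n) is obtained from τ n by the recursive simulator of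
-- the successor.  If Rec simulates g via τ by h, then g is total and g x is the
-- unique y with τ y = h (τ x), which is found by unbounded search.  So the
-- pullback of Rec along τ is Rec again.  Both parts of the theorem follow,
-- since a simulation composed with a simulation is a simulation.
module Submission where

open import Defs
open import Data.Nat using (ℕ; zero; suc; _+_; _∸_; pred; _<_; ∣_-_∣)
open import Data.Nat.Properties
  using (+-identityʳ; pred[m∸n]≡m∸[1+n]; ∣n-n∣≡0; ∣m-n∣≡0⇒m≡n; <-irrefl)
open import Data.Fin using () renaming (zero to fz; suc to fs)
open import Data.Vec using (Vec; []; _∷_)
open import Data.Maybe using (Maybe; just; nothing) renaming (map to mapMaybe)
open import Data.Maybe.Properties using (just-injective; map-∘)
open import Data.Product using (∃; _×_; _,_; proj₁; proj₂)
open import Function using (_∘_)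
open import Function.Definitions using (Injective)
open import Function.Construct.Composition using (injective)
open import Relation.Nullary using (¬_; contradiction)
open import Relation.Binary.PropositionalEquality

Computes : PR 1 → (ℕ → ℕ) → Set
Computes c F = ∀ x → Eval c (x ∷ []) (F x)

Computes₂ : PR 2 → (ℕ → ℕ → ℕ) → Set
Computes₂ c F = ∀ x y → Eval c (x ∷ y ∷ []) (F x y)

comp₁ : ∀ {n} → PR 1 → PR n → PR n
comp₁ f g = compF f (λ _ → g)

comp₂ : ∀ {n} → PR 2 → PR n → PR n → PR n
comp₂ f g h = compF f (λ { fz → g ; (fs _) → h })

eval-comp₁ : ∀ {n} {f : PR 1} {g : PR n} {xs y z} →
             Eval g xs y → Eval f (y ∷ []) z → Eval (comp₁ f g) xs z
eval-comp₁ {y = y} evg evf = evComp (y ∷ []) (λ { fz → evg }) evf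

eval-comp₂ : ∀ {n} {f : PR 2} {g h : PR n} {xs y y′ z} →
             Eval g xs y → Eval h xs y′ → Eval f (y ∷ y′ ∷ []) z →
             Eval (comp₂ f g h) xs z
eval-comp₂ {y = y} {y′} evg evh evf =
  evComp (y ∷ y′ ∷ []) (λ { fz → evg ; (fs fz) → evh }) evf

x₀ : ∀ {n} → PR (suc n)
x₀ = projF fz

x₁ : ∀ {n} → PR (suc (suc n))
x₁ = projF (fs fz)

constC : ∀ {n} → ℕ → PR n
constC zero    = zeroF
constC (suc k) = comp₁ succF (constC k)

eval-constC : ∀ {n} k {xs : Vec ℕ n} → Eval (constC k) xs k
eval-constC zero    = evZero
eval-constC (suc k) = eval-comp₁ (eval-constC k) evSucc

predC : PR 1
predC = precF zeroF x₀

predC-computes : Computes predC pred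
predC-computes zero    = evPrec0 evZero
predC-computes (suc x) = evPrecS (predC-computes x) evProj

-- Recursion is on the first argument, so the arguments of _∸_ are swapped.
monusC : PR 2
monusC = precF x₀ (comp₁ predC x₁)

monusC-computes : Computes₂ monusC (λ k a → a ∸ k)
monusC-computes zero    a = evPrec0 evProj
monusC-computes (suc k) a =
  subst (Eval monusC (suc k ∷ a ∷ [])) (pred[m∸n]≡m∸[1+n] a k)
    (evPrecS (monusC-computes k a) (eval-comp₁ evProj (predC-computes (a ∸ k))))

addC : PR 2
addC = precF x₀ (comp₁ succF x₁)

addC-computes : Computes₂ addC _+_
addC-computes zero    a = evPrec0 evProj
addC-computes (suc k) a = evPrecS (addC-computes k a) (eval-comp₁ evProj evSucc)

∣m-n∣≡[m∸n]+[n∸m] : ∀ m n → ∣ m - n ∣ ≡ (m ∸ n) + (n ∸ m)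
∣m-n∣≡[m∸n]+[n∸m] zero    zero    = refl
∣m-n∣≡[m∸n]+[n∸m] zero    (suc n) = refl
∣m-n∣≡[m∸n]+[n∸m] (suc m) zero    = sym (+-identityʳ (suc m))
∣m-n∣≡[m∸n]+[n∸m] (suc m) (suc n) = ∣m-n∣≡[m∸n]+[n∸m] m n

distC : PR 2
distC = comp₂ addC (comp₂ monusC x₁ x₀) (comp₂ monusC x₀ x₁)

distC-computes : Computes₂ distC ∣_-_∣
distC-computes a b =
  subst (Eval distC (a ∷ b ∷ [])) (sym (∣m-n∣≡[m∸n]+[n∸m] a b))
    (eval-comp₂ (eval-comp₂ evProj evProj (monusC-computes b a))
                (eval-comp₂ evProj evProj (monusC-computes a b))
                (addC-computes (a ∸ b) (b ∸ a)))

∣m-n∣-suc : ∀ {m n} → m ≢ n → ∃ λ k → ∣ m - n ∣ ≡ suc k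
∣m-n∣-suc {m} {n} m≢n with ∣ m - n ∣ in eq
... | zero  = contradiction (∣m-n∣≡0⇒m≡n eq) m≢n
... | suc k = k , refl

iterateC : ℕ → PR 1 → PR 1
iterateC a S = precF (constC a) (comp₁ S x₁)

iterateC-computes : ∀ {S σ τ} → Computes S σ → (∀ n → τ (suc n) ≡ σ (τ n)) →
                    Computes (iterateC (τ 0) S) τ
iterateC-computes {τ = τ} S-σ step zero    = evPrec0 (eval-constC (τ 0))
iterateC-computes {τ = τ} S-σ step (suc n) =
  subst (Eval _ (suc n ∷ [])) (sym (step n))
    (evPrecS (iterateC-computes S-σ step n) (eval-comp₁ evProj (S-σ (τ n))))

preimageC : PR 1 → PR 1 → PR 1
preimageC T K = muF (comp₂ distC (comp₁ T x₀) (comp₁ K x₁))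

preimageC-computes : ∀ {T K τ κ} → Computes T τ → Computes K κ →
                     Injective _≡_ _≡_ τ →
                     ∀ {x y} → τ y ≡ κ x → Eval (preimageC T K) (x ∷ []) y
preimageC-computes {T} {K} {τ} {κ} T-τ K-κ τ-inj {x} {y} τy≡κx =
  evMu (subst (Eval test (y ∷ x ∷ [])) τy-hit (test-computes y)) below
  where
  test : PR 2
  test = comp₂ distC (comp₁ T x₀) (comp₁ K x₁)

  test-computes : ∀ z → Eval test (z ∷ x ∷ []) ∣ τ z - κ x ∣
  test-computes z = eval-comp₂ (eval-comp₁ evProj (T-τ z)) (eval-comp₁ evProj (K-κ x))
                               (distC-computes (τ z) (κ x))

  τy-hit : ∣ τ y - κ x ∣ ≡ 0
  τy-hit = trans (cong (λ w → ∣ w - κ x ∣) τy≡κx) (∣n-n∣≡0 (κ x))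

  below : ∀ z → z < y → ∃ λ k → Eval test (z ∷ x ∷ []) (suc k)
  below z z<y with ∣m-n∣-suc (λ τz≡κx → <-irrefl (τ-inj (trans τz≡κx (sym τy≡κx))) z<y)
  ... | k , miss = k , subst (Eval test (z ∷ x ∷ [])) miss (test-computes z)

Rec-value : ∀ {f} → Rec f → ℕ → ℕ
Rec-value (_ , total) x = proj₁ (total x)

Rec-value-≡ : ∀ {f} (r : Rec f) x → f x ≡ just (Rec-value r x)
Rec-value-≡ (_ , total) x = proj₁ (proj₂ (total x))

Rec-value-computes : ∀ {f} (r : Rec f) → Computes (proj₁ r) (Rec-value r)
Rec-value-computes (_ , total) x = proj₂ (proj₂ (total x))

Commutes-just : ∀ {D E} {ρ : E → D} {g f} → Commutes ρ g f →
                ∀ {x v} → f (ρ x) ≡ just v → ∃ λ y → g x ≡ just y × ρ y ≡ v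
Commutes-just {g = g} ρ-g {x} fρx≡v with g x | ρ-g x
... | just y  | eq = y , refl , just-injective (trans eq fρx≡v)
... | nothing | eq = contradiction (trans eq fρx≡v) λ ()

sucᴹ : ℕ → Maybe ℕ
sucᴹ = just ∘ suc

Rec-suc : Rec sucᴹ
Rec-suc = succF , λ x → suc x , refl , evSucc

Pullback-Rec⊆Rec : ∀ {τ} → Injective _≡_ _≡_ τ → Pullback τ Rec sucᴹ →
                   Pullback τ Rec ⊆ Rec
Pullback-Rec⊆Rec {τ} τ-inj (s , Rec-s , τ-suc) g (h , Rec-h , τ-g) =
  preimageC T K , λ x →
    let y , gx≡y , τy≡ = Commutes-just {ρ = τ} {g} {h} τ-g (Rec-value-≡ Rec-h (τ x))
    in  y , gx≡y , preimageC-computes T-τ K-hτ τ-inj τy≡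
  where
  T : PR 1
  T = iterateC (τ 0) (proj₁ Rec-s)

  T-τ : Computes T τ
  T-τ = iterateC-computes (Rec-value-computes Rec-s)
          (λ n → just-injective (trans (τ-suc n) (Rec-value-≡ Rec-s (τ n))))

  K : PR 1
  K = comp₁ (proj₁ Rec-h) T

  K-hτ : Computes K (Rec-value Rec-h ∘ τ)
  K-hτ x = eval-comp₁ (T-τ x) (Rec-value-computes Rec-h (τ x))

Pullback-∘ : ∀ {A B C} {M : Model B} {N : Model C} (ρ : A → B) (σ : B → C) →
             M ⊆ Pullback σ N → Pullback ρ M ⊆ Pullback (σ ∘ ρ) N
Pullback-∘ ρ σ M⊆σ*N g (f , Mf , ρ-g) with M⊆σ*N f Mf
... | h , Nh , σ-f = h , Nh , λ x → begin
  mapMaybe (σ ∘ ρ) (g x)          ≡⟨ map-∘ (g x) ⟩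
  mapMaybe σ (mapMaybe ρ (g x))   ≡⟨ cong (mapMaybe σ) (ρ-g x) ⟩
  mapMaybe σ (f (ρ x))            ≡⟨ σ-f (ρ x) ⟩
  h (σ (ρ x))                     ∎
  where open ≡-Reasoning

mainTheorem2 : ((M : Model ℕ) → Rec ⊆ M → Simulates Rec M → M ≐ Rec)
    × ((D : Set) (M : Model D) → ¬ (Hypercomputational M × Simulates Rec M))
mainTheorem2 = completeness , no-hypercomputation
  where
  completeness : (M : Model ℕ) → Rec ⊆ M → Simulates Rec M → M ≐ Rec
  completeness M Rec⊆M (ρ , ρ-inj , M⊆ρ*Rec) = M⊆Rec , Rec⊆M
    where
    M⊆Rec : M ⊆ Rec
    M⊆Rec g Mg = Pullback-Rec⊆Rec ρ-inj (M⊆ρ*Rec sucᴹ (Rec⊆M sucᴹ Rec-suc)) g (M⊆ρ*Rec g Mg)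

  no-hypercomputation : (D : Set) (M : Model D) → ¬ (Hypercomputational M × Simulates Rec M)
  no-hypercomputation D M ((ρ , ρ-inj , Rec⊆ρ*M , g , ρ*M-g , ¬Rec-g) , (σ , σ-inj , M⊆σ*Rec)) =
    ¬Rec-g (Pullback-Rec⊆Rec σρ-inj (ρ*M⊆σρ*Rec sucᴹ (Rec⊆ρ*M sucᴹ Rec-suc)) g (ρ*M⊆σρ*Rec g ρ*M-g))
    where
    σρ-inj : Injective _≡_ _≡_ (σ ∘ ρ)
    σρ-inj = injective _≡_ _≡_ _≡_ ρ-inj σ-inj

    ρ*M⊆σρ*Rec : Pullback ρ M ⊆ Pullback (σ ∘ ρ) Rec
    ρ*M⊆σρ*Rec = Pullback-∘ ρ σ M⊆σ*Rec
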